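{- Let $n\geq 5$. Then every edge of $\Lambda_n$ has imbalance at most $2$. Moreover, if $A$, $B$, $C$ are the sets of edges of $\Lambda_n$ with imbalance $0$, $1$ and $2$ respectively, then $|A|=nF_{n-5}$, $|B|=2nF_{n-4}$ and $|C|=nF_{n-3}$.
   Context: $\Lambda_n$ is the subgraph of the hypercube $Q_n$ (binary strings of length $n$, adjacent iff differing in exactly one position) induced by the binary strings $b_1\ldots b_n$ with no two consecutive 1's and $b_1b_n\neq 1$. The imbalance of an edge $\{x,y\}$ is $|d(x)-d(y)|$ with degrees in $\Lambda_n$. $F_n$ is the Fibonacci sequence $F_0=0$, $F_1=1$, $F_n=F_{n-1}+F_{n-2}$. -}

module Defs where

open import Data.Bool using (Bool; true; false; _∧_; _∨_; not; T)
open import Data.Nat using (ℕ; zero; suc; _+_; ∣_-_∣; _≟_)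
open import Data.Vec using (Vec; []; _∷_; head; last)
open import Data.List using (List; []; _∷_; map; _++_; filter; length; concatMap)
open import Data.Product using (_×_; _,_; proj₁; proj₂)
open import Relation.Nullary.Decidable using (Dec; T?)
open import Relation.Binary.PropositionalEquality using (_≡_)

fib : ℕ → ℕ
fib zero = 0
fib (suc zero) = 1
fib (suc (suc n)) = fib (suc n) + fib n

allStrings : (n : ℕ) → List (Vec Bool n)
allStrings zero = [] ∷ []
allStrings (suc n) = map (false ∷_) (allStrings n) ++ map (true ∷_) (allStrings n)

noConsecOnes : ∀ {n} → Vec Bool n → Bool
noConsecOnes [] = true
noConsecOnes (b ∷ []) = true
noConsecOnes (b ∷ c ∷ bs) = not (b ∧ c) ∧ noConsecOnes (c ∷ bs)

firstLastOk : ∀ {n} → Vec Bool n → Bool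
firstLastOk [] = true
firstLastOk (b ∷ bs) = not (b ∧ last (b ∷ bs))

isLucasString : ∀ {n} → Vec Bool n → Bool
isLucasString v = noConsecOnes v ∧ firstLastOk v

vertices : (n : ℕ) → List (Vec Bool n)
vertices n = filter (λ v → T? (isLucasString v)) (allStrings n)

hamming : ∀ {n} → Vec Bool n → Vec Bool n → ℕ
hamming [] [] = 0
hamming (true ∷ xs) (false ∷ ys) = suc (hamming xs ys)
hamming (false ∷ xs) (true ∷ ys) = suc (hamming xs ys)
hamming (_ ∷ xs) (_ ∷ ys) = hamming xs ys

Adjacent : ∀ {n} → Vec Bool n → Vec Bool n → Set
Adjacent x y = hamming x y ≡ 1

adjacent? : ∀ {n} (x y : Vec Bool n) → Dec (Adjacent x y)
adjacent? x y = hamming x y ≟ 1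

degree : (n : ℕ) → Vec Bool n → ℕ
degree n x = length (filter (adjacent? x) (vertices n))

pairs : ∀ {a} {A : Set a} → List A → List (A × A)
pairs [] = []
pairs (x ∷ xs) = map (x ,_) xs ++ pairs xs

-- edge set of Λ_n: each edge {x,y} listed exactly once
edges : (n : ℕ) → List (Vec Bool n × Vec Bool n)
edges n = filter (λ e → adjacent? (proj₁ e) (proj₂ e)) (pairs (vertices n))

imbalance : (n : ℕ) → Vec Bool n × Vec Bool n → ℕ
imbalance n (x , y) = ∣ degree n x - degree n y ∣

edgesWithImbalance : (n k : ℕ) → List (Vec Bool n × Vec Bool n)
edgesWithImbalance n k = filter (λ e → imbalance n e ≟ k) (edges n)

module Submission where

-- Rotating a string is an automorphism of Λ_n, so each of the n bit positions carries the same number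
-- of edges of a given imbalance, and it suffices to count the edges flipping the third bit.  Such an
-- edge pqxrs⋯ ~ pqx̄rs⋯ joins two Lucas strings only when q = r = 0, and then only the flippability of
-- q and r differs between its ends: setting q needs p = 0 and setting r needs s = 0.  Its imbalance is
-- therefore [p = 0] + [s = 0] ≤ 2, and for fixed p and s the admissible tails s⋯ are counted by
-- Fibonacci numbers.

open import Defs
open import Data.Bool using (Bool; true; false; _∧_; not)
open import Data.Bool.Properties using (∧-comm; ∧-assoc; ∧-zeroʳ; ∧-identityʳ; ∧-commutativeMonoid)
open import Data.Nat using (ℕ; zero; suc; _+_; _*_; _∸_; ∣_-_∣; _≤_; _<_; s≤s; z≤n)
open import Algebra.Bundles using (CommutativeMonoid)
open import Data.Nat.Properties
  using (_≟_; _<?_; +-comm; +-assoc; +-identityʳ; *-comm; *-zeroʳ; *-distribˡ-+; *-cancelˡ-≡;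
         ∣-∣-comm; ∣m-m+n∣≡n; ≮⇒≥; <-trans; n<1+n; +-commutativeSemigroup; *-commutativeSemigroup)
open import Algebra.Properties.CommutativeSemigroup +-commutativeSemigroup
  using () renaming (interchange to +-interchange)
open import Algebra.Properties.CommutativeSemigroup *-commutativeSemigroup
  using () renaming (x∙yz≈y∙xz to x*yz≡y*xz)
open import Algebra.Properties.CommutativeSemigroup (CommutativeMonoid.commutativeSemigroup ∧-commutativeMonoid)
  using () renaming (x∙yz≈y∙xz to ∧-swap)
open import Data.Nat.Tactic.RingSolver using (solve-∀)
open import Data.Vec using (Vec; []; _∷_; last; _∷ʳ_)
open import Data.Vec.Properties using (last-∷ʳ)
open import Data.List using (List; []; _∷_; map; _++_; filter; length)
open import Data.List.Relation.Unary.All as All using (All; []; _∷_)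
open import Data.Product using (_×_; _,_; proj₁; proj₂; uncurry)
open import Level using (Level)
open import Relation.Nullary using (does; yes; no)
open import Relation.Nullary.Decidable using (T?)
open import Relation.Unary using (Pred; Decidable; ∁)
open import Relation.Binary.PropositionalEquality
open ≡-Reasoning

𝟙 : Bool → ℕ
𝟙 true = 1
𝟙 false = 0

𝟙-∧ : ∀ a b → 𝟙 (a ∧ b) ≡ 𝟙 a * 𝟙 b
𝟙-∧ true b = sym (+-identityʳ (𝟙 b))
𝟙-∧ false b = refl

private
  variable
    A B : Set

sumBy : (A → ℕ) → List A → ℕ
sumBy f [] = 0
sumBy f (x ∷ xs) = f x + sumBy f xs

sumBy-cong : ∀ {f g : A → ℕ} → (∀ x → f x ≡ g x) → ∀ xs → sumBy f xs ≡ sumBy g xs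
sumBy-cong f≗g [] = refl
sumBy-cong f≗g (x ∷ xs) = cong₂ _+_ (f≗g x) (sumBy-cong f≗g xs)

sumBy-++ : ∀ (f : A → ℕ) xs ys → sumBy f (xs ++ ys) ≡ sumBy f xs + sumBy f ys
sumBy-++ f [] ys = refl
sumBy-++ f (x ∷ xs) ys = trans (cong (f x +_) (sumBy-++ f xs ys)) (sym (+-assoc (f x) _ _))

sumBy-map : ∀ (f : A → ℕ) (g : B → A) xs → sumBy f (map g xs) ≡ sumBy (λ x → f (g x)) xs
sumBy-map f g [] = refl
sumBy-map f g (x ∷ xs) = cong (f (g x) +_) (sumBy-map f g xs)

sumBy-+ : ∀ (f g : A → ℕ) xs → sumBy (λ x → f x + g x) xs ≡ sumBy f xs + sumBy g xs
sumBy-+ f g [] = refl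
sumBy-+ f g (x ∷ xs) = trans (cong (f x + g x +_) (sumBy-+ f g xs)) (+-interchange (f x) (g x) _ _)

sumBy-zero : ∀ {f : A → ℕ} → (∀ x → f x ≡ 0) → ∀ xs → sumBy f xs ≡ 0
sumBy-zero f≗0 [] = refl
sumBy-zero f≗0 (x ∷ xs) = cong₂ _+_ (f≗0 x) (sumBy-zero f≗0 xs)

module _ {A : Set} {ℓ : Level} {P : Pred A ℓ} (P? : Decidable P) where

  sumBy-filter : ∀ (f : A → ℕ) xs → sumBy f (filter P? xs) ≡ sumBy (λ x → 𝟙 (does (P? x)) * f x) xs
  sumBy-filter f [] = refl
  sumBy-filter f (x ∷ xs) with does (P? x)
  ... | false = sumBy-filter f xs
  ... | true = cong₂ _+_ (sym (+-identityʳ (f x))) (sumBy-filter f xs)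

  length-filter≡sumBy : ∀ xs → length (filter P? xs) ≡ sumBy (λ x → 𝟙 (does (P? x))) xs
  length-filter≡sumBy [] = refl
  length-filter≡sumBy (x ∷ xs) with does (P? x)
  ... | false = length-filter≡sumBy xs
  ... | true = cong suc (length-filter≡sumBy xs)

  length-filter≡0⇒All∁ : ∀ xs → length (filter P? xs) ≡ 0 → All (∁ P) xs
  length-filter≡0⇒All∁ [] _ = []
  length-filter≡0⇒All∁ (x ∷ xs) len≡0 with P? x
  ... | no ¬px = ¬px ∷ length-filter≡0⇒All∁ xs len≡0
  length-filter≡0⇒All∁ (x ∷ xs) () | yes _

length-filter-filter : ∀ {ℓ₁ ℓ₂} {P : Pred A ℓ₁} {Q : Pred A ℓ₂} (P? : Decidable P) (Q? : Decidable Q) →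
  ∀ xs →
  length (filter Q? (filter P? xs)) ≡ sumBy (λ x → 𝟙 (does (P? x)) * 𝟙 (does (Q? x))) xs
length-filter-filter P? Q? xs = trans (length-filter≡sumBy Q? (filter P? xs)) (sumBy-filter P? _ xs)

sumBy-pairs : (G : A → A → ℕ) → (∀ x y → G x y ≡ G y x) → ∀ xs →
  2 * sumBy (uncurry G) (pairs xs) + sumBy (λ x → G x x) xs ≡ sumBy (λ x → sumBy (G x) xs) xs
sumBy-pairs G G-sym [] = refl
sumBy-pairs G G-sym (x ∷ xs) =
  begin
    2 * sumBy (uncurry G) (map (x ,_) xs ++ pairs xs) + (G x x + diag)
  ≡⟨ cong (λ s → 2 * s + (G x x + diag))
       (trans (sumBy-++ (uncurry G) (map (x ,_) xs) (pairs xs)) (cong (_+ rest) (sumBy-map (uncurry G) (x ,_) xs))) ⟩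
    2 * (row + rest) + (G x x + diag)
  ≡⟨ regroup row rest (G x x) diag ⟩
    G x x + row + (row + (2 * rest + diag))
  ≡⟨ cong (G x x + row +_) (cong₂ _+_ (sumBy-cong (G-sym x) xs) (sumBy-pairs G G-sym xs)) ⟩
    G x x + row + (sumBy (λ y → G y x) xs + sumBy (λ y → sumBy (G y) xs) xs)
  ≡⟨ cong (G x x + row +_) (sym (sumBy-+ (λ y → G y x) (λ y → sumBy (G y) xs) xs)) ⟩
    G x x + row + sumBy (λ y → G y x + sumBy (G y) xs) xs
  ∎
  where
  row rest diag : ℕ
  row = sumBy (G x) xs
  rest = sumBy (uncurry G) (pairs xs)
  diag = sumBy (λ y → G y y) xs
  regroup : ∀ r p g d → 2 * (r + p) + (g + d) ≡ g + r + (r + (2 * p + d))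
  regroup = solve-∀

∑Strings : (n : ℕ) → (Vec Bool n → ℕ) → ℕ
∑Strings zero f = f []
∑Strings (suc n) f = ∑Strings n (λ v → f (false ∷ v)) + ∑Strings n (λ v → f (true ∷ v))

∑Strings-cong : ∀ n {f g : Vec Bool n → ℕ} → (∀ v → f v ≡ g v) → ∑Strings n f ≡ ∑Strings n g
∑Strings-cong zero f≗g = f≗g []
∑Strings-cong (suc n) f≗g =
  cong₂ _+_ (∑Strings-cong n (λ v → f≗g (false ∷ v))) (∑Strings-cong n (λ v → f≗g (true ∷ v)))

∑Strings-zero : ∀ n {f : Vec Bool n → ℕ} → (∀ v → f v ≡ 0) → ∑Strings n f ≡ 0
∑Strings-zero zero f≗0 = f≗0 []
∑Strings-zero (suc n) f≗0 =
  cong₂ _+_ (∑Strings-zero n (λ v → f≗0 (false ∷ v))) (∑Strings-zero n (λ v → f≗0 (true ∷ v)))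

∑Strings-+ : ∀ n (f g : Vec Bool n → ℕ) → ∑Strings n (λ v → f v + g v) ≡ ∑Strings n f + ∑Strings n g
∑Strings-+ zero f g = refl
∑Strings-+ (suc n) f g =
  trans (cong₂ _+_ (∑Strings-+ n (λ v → f (false ∷ v)) (λ v → g (false ∷ v)))
                   (∑Strings-+ n (λ v → f (true ∷ v)) (λ v → g (true ∷ v))))
        (+-interchange (∑Strings n (λ v → f (false ∷ v))) _ _ _)

∑Strings-*ˡ : ∀ n c (f : Vec Bool n → ℕ) → ∑Strings n (λ v → c * f v) ≡ c * ∑Strings n f
∑Strings-*ˡ zero c f = refl
∑Strings-*ˡ (suc n) c f =
  trans (cong₂ _+_ (∑Strings-*ˡ n c (λ v → f (false ∷ v))) (∑Strings-*ˡ n c (λ v → f (true ∷ v))))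
        (sym (*-distribˡ-+ c _ _))

sumBy-allStrings : ∀ n (f : Vec Bool n → ℕ) → sumBy f (allStrings n) ≡ ∑Strings n f
sumBy-allStrings zero f = +-identityʳ (f [])
sumBy-allStrings (suc n) f =
  trans (sumBy-++ f (map (false ∷_) (allStrings n)) _)
        (cong₂ _+_ (trans (sumBy-map f _ (allStrings n)) (sumBy-allStrings n _))
                   (trans (sumBy-map f _ (allStrings n)) (sumBy-allStrings n _)))

rotate : ∀ {n} → Vec A n → Vec A n
rotate [] = []
rotate (x ∷ w) = w ∷ʳ x

∑Strings-∷ʳ : ∀ m (f : Vec Bool (suc m) → ℕ) →
  ∑Strings (suc m) f ≡ ∑Strings m (λ w → f (w ∷ʳ false) + f (w ∷ʳ true))
∑Strings-∷ʳ zero f = refl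
∑Strings-∷ʳ (suc m) f =
  cong₂ _+_ (∑Strings-∷ʳ m (λ v → f (false ∷ v))) (∑Strings-∷ʳ m (λ v → f (true ∷ v)))

∑Strings-rotate : ∀ n (f : Vec Bool n → ℕ) → ∑Strings n (λ u → f (rotate u)) ≡ ∑Strings n f
∑Strings-rotate zero f = refl
∑Strings-rotate (suc m) f =
  sym (trans (∑Strings-∷ʳ m f) (∑Strings-+ m (λ w → f (w ∷ʳ false)) (λ w → f (w ∷ʳ true))))

∑Below : ℕ → (ℕ → ℕ) → ℕ
∑Below zero f = 0
∑Below (suc k) f = f 0 + ∑Below k (λ j → f (suc j))

∑Below-cong : ∀ k {f g : ℕ → ℕ} → (∀ j → f j ≡ g j) → ∑Below k f ≡ ∑Below k g
∑Below-cong zero f≗g = refl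
∑Below-cong (suc k) f≗g = cong₂ _+_ (f≗g 0) (∑Below-cong k (λ j → f≗g (suc j)))

∑Below-*ˡ : ∀ k c (f : ℕ → ℕ) → ∑Below k (λ j → c * f j) ≡ c * ∑Below k f
∑Below-*ˡ zero c f = sym (*-zeroʳ c)
∑Below-*ˡ (suc k) c f =
  trans (cong (c * f 0 +_) (∑Below-*ˡ k c (λ j → f (suc j)))) (sym (*-distribˡ-+ c _ _))

∑Below-const : ∀ k (f : ℕ → ℕ) c → (∀ j → j < k → f j ≡ c) → ∑Below k f ≡ k * c
∑Below-const zero f c f≡c = refl
∑Below-const (suc k) f c f≡c =
  cong₂ _+_ (f≡c 0 (s≤s z≤n)) (∑Below-const k (λ j → f (suc j)) c (λ j j<k → f≡c (suc j) (s≤s j<k)))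

∑Strings-∑Below : ∀ n k (F : Vec Bool n → ℕ → ℕ) →
  ∑Strings n (λ u → ∑Below k (F u)) ≡ ∑Below k (λ j → ∑Strings n (λ u → F u j))
∑Strings-∑Below n zero F = ∑Strings-zero n (λ _ → refl)
∑Strings-∑Below n (suc k) F =
  trans (∑Strings-+ n (λ u → F u 0) (λ u → ∑Below k (λ j → F u (suc j))))
        (cong (∑Strings n (λ u → F u 0) +_) (∑Strings-∑Below n k (λ u j → F u (suc j))))

flipAt : ∀ {n} → ℕ → Vec Bool n → Vec Bool n
flipAt _ [] = []
flipAt zero (b ∷ v) = not b ∷ v
flipAt (suc j) (b ∷ v) = b ∷ flipAt j v

∑Neighbours : ∀ {n} → (Vec Bool n → ℕ) → Vec Bool n → ℕ
∑Neighbours {n} f u = ∑Below n (λ j → f (flipAt j u))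

∑Strings-hamming≡0 : ∀ n x (f : Vec Bool n → ℕ) →
  ∑Strings n (λ v → 𝟙 (does (hamming x v ≟ 0)) * f v) ≡ f x
∑Strings-hamming≡0 zero [] f = +-identityʳ (f [])
∑Strings-hamming≡0 (suc n) (false ∷ x) f =
  trans (cong₂ _+_ (∑Strings-hamming≡0 n x (λ v → f (false ∷ v))) (∑Strings-zero n (λ _ → refl))) (+-identityʳ _)
∑Strings-hamming≡0 (suc n) (true ∷ x) f =
  cong₂ _+_ (∑Strings-zero n (λ _ → refl)) (∑Strings-hamming≡0 n x (λ v → f (true ∷ v)))

∑Strings-adjacent : ∀ n x (f : Vec Bool n → ℕ) →
  ∑Strings n (λ v → 𝟙 (does (adjacent? x v)) * f v) ≡ ∑Neighbours f x
∑Strings-adjacent zero [] f = refl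
∑Strings-adjacent (suc n) (false ∷ x) f =
  trans (cong₂ _+_ (∑Strings-adjacent n x (λ v → f (false ∷ v)))
                   (∑Strings-hamming≡0 n x (λ v → f (true ∷ v))))
        (+-comm (∑Neighbours (λ v → f (false ∷ v)) x) (f (true ∷ x)))
∑Strings-adjacent (suc n) (true ∷ x) f =
  cong₂ _+_ (∑Strings-hamming≡0 n x (λ v → f (false ∷ v))) (∑Strings-adjacent n x (λ v → f (true ∷ v)))

hamming-sym : ∀ {n} (x y : Vec Bool n) → hamming x y ≡ hamming y x
hamming-sym [] [] = refl
hamming-sym (true ∷ x) (true ∷ y) = hamming-sym x y
hamming-sym (true ∷ x) (false ∷ y) = cong suc (hamming-sym x y)
hamming-sym (false ∷ x) (true ∷ y) = cong suc (hamming-sym x y)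
hamming-sym (false ∷ x) (false ∷ y) = hamming-sym x y

hamming-self : ∀ {n} (x : Vec Bool n) → hamming x x ≡ 0
hamming-self [] = refl
hamming-self (true ∷ x) = hamming-self x
hamming-self (false ∷ x) = hamming-self x

hamming-∷ : ∀ {n} a b (x y : Vec Bool n) → hamming (a ∷ x) (b ∷ y) ≡ hamming (a ∷ []) (b ∷ []) + hamming x y
hamming-∷ true true x y = refl
hamming-∷ true false x y = refl
hamming-∷ false true x y = refl
hamming-∷ false false x y = refl

hamming-∷ʳ : ∀ {n} (x y : Vec Bool n) a b → hamming (x ∷ʳ a) (y ∷ʳ b) ≡ hamming x y + hamming (a ∷ []) (b ∷ [])
hamming-∷ʳ [] [] a b = refl
hamming-∷ʳ (true ∷ x) (true ∷ y) a b = hamming-∷ʳ x y a b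
hamming-∷ʳ (true ∷ x) (false ∷ y) a b = cong suc (hamming-∷ʳ x y a b)
hamming-∷ʳ (false ∷ x) (true ∷ y) a b = cong suc (hamming-∷ʳ x y a b)
hamming-∷ʳ (false ∷ x) (false ∷ y) a b = hamming-∷ʳ x y a b

hamming-rotate : ∀ {n} (x y : Vec Bool n) → hamming (rotate x) (rotate y) ≡ hamming x y
hamming-rotate [] [] = refl
hamming-rotate (a ∷ x) (b ∷ y) =
  trans (hamming-∷ʳ x y a b) (trans (+-comm (hamming x y) _) (sym (hamming-∷ a b x y)))

flipAt-∷ʳ : ∀ {m} j (w : Vec Bool m) x → j < m → flipAt j (w ∷ʳ x) ≡ flipAt j w ∷ʳ x
flipAt-∷ʳ zero (b ∷ w) x _ = refl
flipAt-∷ʳ (suc j) (b ∷ w) x (s≤s j<m) = cong (b ∷_) (flipAt-∷ʳ j w x j<m)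

rotate-flipAt : ∀ {n} j (u : Vec Bool n) → suc j < n → rotate (flipAt (suc j) u) ≡ flipAt j (rotate u)
rotate-flipAt j (x ∷ w) (s≤s j<m) = sym (flipAt-∷ʳ j w x j<m)

noConsecOnes-∷ʳ : ∀ {m} a (v : Vec Bool m) b →
  noConsecOnes ((a ∷ v) ∷ʳ b) ≡ noConsecOnes (a ∷ v) ∧ not (last (a ∷ v) ∧ b)
noConsecOnes-∷ʳ a [] b = ∧-identityʳ _
noConsecOnes-∷ʳ a (c ∷ v) b =
  trans (cong (not (a ∧ c) ∧_) (noConsecOnes-∷ʳ c v b)) (sym (∧-assoc (not (a ∧ c)) _ _))

isLucasString-rotate : ∀ {n} (u : Vec Bool n) → isLucasString (rotate u) ≡ isLucasString u
isLucasString-rotate [] = refl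
isLucasString-rotate (x ∷ []) = refl
isLucasString-rotate (x ∷ y ∷ w) =
  begin
    noConsecOnes ((y ∷ w) ∷ʳ x) ∧ not (y ∧ last ((y ∷ w) ∷ʳ x))
  ≡⟨ cong₂ (λ a b → a ∧ not (y ∧ b)) (noConsecOnes-∷ʳ y w x) (last-∷ʳ x (y ∷ w)) ⟩
    (N ∧ not (c ∧ x)) ∧ not (y ∧ x)
  ≡⟨ cong₂ (λ a b → (N ∧ not a) ∧ not b) (∧-comm c x) (∧-comm y x) ⟩
    (N ∧ not (x ∧ c)) ∧ not (x ∧ y)
  ≡⟨ ∧-comm _ (not (x ∧ y)) ⟩
    not (x ∧ y) ∧ (N ∧ not (x ∧ c))
  ≡⟨ sym (∧-assoc (not (x ∧ y)) N _) ⟩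
    (not (x ∧ y) ∧ N) ∧ not (x ∧ c)
  ∎
  where
  N c : Bool
  N = noConsecOnes (y ∷ w)
  c = last (y ∷ w)

lucasDegree : ∀ {n} → Vec Bool n → ℕ
lucasDegree = ∑Neighbours (λ v → 𝟙 (isLucasString v))

degree≡lucasDegree : ∀ n (x : Vec Bool n) → degree n x ≡ lucasDegree x
degree≡lucasDegree n x =
  begin
    degree n x
  ≡⟨ length-filter-filter (λ v → T? (isLucasString v)) (adjacent? x) (allStrings n) ⟩
    sumBy (λ v → 𝟙 (isLucasString v) * 𝟙 (does (adjacent? x v))) (allStrings n)
  ≡⟨ sumBy-allStrings n _ ⟩
    ∑Strings n (λ v → 𝟙 (isLucasString v) * 𝟙 (does (adjacent? x v)))
  ≡⟨ ∑Strings-cong n (λ v → *-comm (𝟙 (isLucasString v)) _) ⟩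
    ∑Strings n (λ v → 𝟙 (does (adjacent? x v)) * 𝟙 (isLucasString v))
  ≡⟨ ∑Strings-adjacent n x _ ⟩
    lucasDegree x
  ∎

lucasDegree-rotate : ∀ {n} (u : Vec Bool n) → lucasDegree (rotate u) ≡ lucasDegree u
lucasDegree-rotate {n} u =
  begin
    lucasDegree (rotate u)
  ≡⟨ sym (∑Strings-adjacent n (rotate u) _) ⟩
    ∑Strings n (λ v → 𝟙 (does (adjacent? (rotate u) v)) * 𝟙 (isLucasString v))
  ≡⟨ sym (∑Strings-rotate n _) ⟩
    ∑Strings n (λ v → 𝟙 (does (adjacent? (rotate u) (rotate v))) * 𝟙 (isLucasString (rotate v)))
  ≡⟨ ∑Strings-cong n (λ v → cong₂ (λ h b → 𝟙 (does (h ≟ 1)) * 𝟙 b)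
                                   (hamming-rotate u v) (isLucasString-rotate v)) ⟩
    ∑Strings n (λ v → 𝟙 (does (adjacent? u v)) * 𝟙 (isLucasString v))
  ≡⟨ ∑Strings-adjacent n u _ ⟩
    lucasDegree u
  ∎

lucasPairWith : ∀ {n} → (ℕ → Bool) → Vec Bool n → Vec Bool n → Bool
lucasPairWith P u v = isLucasString u ∧ (isLucasString v ∧ P ∣ lucasDegree u - lucasDegree v ∣)

lucasPairWith-sym : ∀ {n} P (u v : Vec Bool n) → lucasPairWith P u v ≡ lucasPairWith P v u
lucasPairWith-sym P u v =
  trans (∧-swap (isLucasString u) (isLucasString v) _)
        (cong (λ d → isLucasString v ∧ (isLucasString u ∧ P d)) (∣-∣-comm (lucasDegree u) (lucasDegree v)))

lucasPairWith-rotate : ∀ {n} P (u v : Vec Bool n) → lucasPairWith P (rotate u) (rotate v) ≡ lucasPairWith P u v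
lucasPairWith-rotate P u v
  rewrite isLucasString-rotate u | isLucasString-rotate v | lucasDegree-rotate u | lucasDegree-rotate v = refl

flipCount : ∀ n → (ℕ → Bool) → ℕ → ℕ
flipCount n P j = ∑Strings n (λ u → 𝟙 (lucasPairWith P u (flipAt j u)))

flipCount-suc : ∀ n P j → suc j < n → flipCount n P (suc j) ≡ flipCount n P j
flipCount-suc n P j 1+j<n =
  begin
    flipCount n P (suc j)
  ≡⟨ ∑Strings-cong n (λ u → cong 𝟙 (sym (lucasPairWith-rotate P u (flipAt (suc j) u)))) ⟩
    ∑Strings n (λ u → 𝟙 (lucasPairWith P (rotate u) (rotate (flipAt (suc j) u))))
  ≡⟨ ∑Strings-cong n (λ u → cong (λ v → 𝟙 (lucasPairWith P (rotate u) v)) (rotate-flipAt j u 1+j<n)) ⟩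
    ∑Strings n (λ u → 𝟙 (lucasPairWith P (rotate u) (flipAt j (rotate u))))
  ≡⟨ ∑Strings-rotate n (λ u → 𝟙 (lucasPairWith P u (flipAt j u))) ⟩
    flipCount n P j
  ∎

flipCount-const : ∀ n P j → j < n → flipCount n P j ≡ flipCount n P 0
flipCount-const n P zero _ = refl
flipCount-const n P (suc j) 1+j<n =
  trans (flipCount-suc n P j 1+j<n) (flipCount-const n P j (<-trans (n<1+n j) 1+j<n))

sumBy-vertices : ∀ n (f : Vec Bool n → ℕ) →
  sumBy f (vertices n) ≡ ∑Strings n (λ u → 𝟙 (isLucasString u) * f u)
sumBy-vertices n f = trans (sumBy-filter (λ v → T? (isLucasString v)) f (allStrings n)) (sumBy-allStrings n _)

adjacentWith : ∀ n → (ℕ → Bool) → Vec Bool n → Vec Bool n → ℕ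
adjacentWith n P u v = 𝟙 (does (adjacent? u v)) * 𝟙 (P ∣ degree n u - degree n v ∣)

∑Strings-adjacentWith : ∀ n P (u : Vec Bool n) →
  𝟙 (isLucasString u) * ∑Strings n (λ v → 𝟙 (isLucasString v) * adjacentWith n P u v)
    ≡ ∑Neighbours (λ v → 𝟙 (lucasPairWith P u v)) u
∑Strings-adjacentWith n P u =
  begin
    𝟙 Lu * ∑Strings n (λ v → 𝟙 (isLucasString v) * adjacentWith n P u v)
  ≡⟨ cong (𝟙 Lu *_) (∑Strings-cong n incidence) ⟩
    𝟙 Lu * ∑Strings n (λ v → 𝟙 (does (adjacent? u v)) * 𝟙 (isLucasString v ∧ P ∣ lucasDegree u - lucasDegree v ∣))
  ≡⟨ cong (𝟙 Lu *_) (∑Strings-adjacent n u _) ⟩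
    𝟙 Lu * ∑Neighbours (λ v → 𝟙 (isLucasString v ∧ P ∣ lucasDegree u - lucasDegree v ∣)) u
  ≡⟨ sym (∑Below-*ˡ n (𝟙 Lu) _) ⟩
    ∑Neighbours (λ v → 𝟙 Lu * 𝟙 (isLucasString v ∧ P ∣ lucasDegree u - lucasDegree v ∣)) u
  ≡⟨ ∑Below-cong n (λ j → sym (𝟙-∧ Lu _)) ⟩
    ∑Neighbours (λ v → 𝟙 (lucasPairWith P u v)) u
  ∎
  where
  Lu : Bool
  Lu = isLucasString u
  incidence : ∀ v → 𝟙 (isLucasString v) * adjacentWith n P u v
                    ≡ 𝟙 (does (adjacent? u v)) * 𝟙 (isLucasString v ∧ P ∣ lucasDegree u - lucasDegree v ∣)
  incidence v =
    trans (x*yz≡y*xz (𝟙 (isLucasString v)) (𝟙 (does (adjacent? u v))) _)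
          (cong (𝟙 (does (adjacent? u v)) *_)
                (trans (sym (𝟙-∧ (isLucasString v) _))
                       (cong (λ d → 𝟙 (isLucasString v ∧ P d))
                             (cong₂ ∣_-_∣ (degree≡lucasDegree n u) (degree≡lucasDegree n v)))))

2*edges≡∑flipCount : ∀ n {ℓ} {Q : Pred ℕ ℓ} (Q? : Decidable Q) →
  2 * length (filter (λ e → Q? (imbalance n e)) (edges n)) ≡ ∑Below n (flipCount n (λ d → does (Q? d)))
2*edges≡∑flipCount n Q? =
  begin
    2 * length (filter (λ e → Q? (imbalance n e)) (edges n))
  ≡⟨ cong (2 *_) (length-filter-filter (λ e → adjacent? (proj₁ e) (proj₂ e)) (λ e → Q? (imbalance n e))
                                      (pairs V)) ⟩
    2 * sumBy (uncurry G) (pairs V)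
  ≡⟨ sym (trans (cong (2 * sumBy (uncurry G) (pairs V) +_) (sumBy-zero G-diag V)) (+-identityʳ _)) ⟩
    2 * sumBy (uncurry G) (pairs V) + sumBy (λ u → G u u) V
  ≡⟨ sumBy-pairs G G-sym V ⟩
    sumBy (λ u → sumBy (G u) V) V
  ≡⟨ sumBy-vertices n _ ⟩
    ∑Strings n (λ u → 𝟙 (isLucasString u) * sumBy (G u) V)
  ≡⟨ ∑Strings-cong n (λ u → cong (𝟙 (isLucasString u) *_) (sumBy-vertices n (G u))) ⟩
    ∑Strings n (λ u → 𝟙 (isLucasString u) * ∑Strings n (λ v → 𝟙 (isLucasString v) * G u v))
  ≡⟨ ∑Strings-cong n (∑Strings-adjacentWith n P) ⟩
    ∑Strings n (λ u → ∑Neighbours (λ v → 𝟙 (lucasPairWith P u v)) u)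
  ≡⟨ ∑Strings-∑Below n n _ ⟩
    ∑Below n (flipCount n P)
  ∎
  where
  P : ℕ → Bool
  P d = does (Q? d)
  V : List (Vec Bool n)
  V = vertices n
  G : Vec Bool n → Vec Bool n → ℕ
  G = adjacentWith n P
  G-sym : ∀ u v → G u v ≡ G v u
  G-sym u v =
    cong₂ (λ h d → 𝟙 (does (h ≟ 1)) * 𝟙 (P d)) (hamming-sym u v) (∣-∣-comm (degree n u) (degree n v))
  G-diag : ∀ u → G u u ≡ 0
  G-diag u = cong (λ h → 𝟙 (does (h ≟ 1)) * 𝟙 (P ∣ degree n u - degree n u ∣)) (hamming-self u)

lucasTail : ∀ {m} → Bool → Vec Bool (suc m) → Bool
lucasTail p z = noConsecOnes z ∧ not (p ∧ last z)

isLucasString-p0x0 : ∀ {m} p x (z : Vec Bool (suc m)) →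
  isLucasString (p ∷ false ∷ x ∷ false ∷ z) ≡ lucasTail p z
isLucasString-p0x0 true true (s ∷ w) = refl
isLucasString-p0x0 true false (s ∷ w) = refl
isLucasString-p0x0 false true (s ∷ w) = refl
isLucasString-p0x0 false false (s ∷ w) = refl

isLucasString-p100 : ∀ {m} p (z : Vec Bool (suc m)) →
  isLucasString (p ∷ true ∷ false ∷ false ∷ z) ≡ not p ∧ lucasTail p z
isLucasString-p100 true z = refl
isLucasString-p100 false (s ∷ w) = refl

isLucasString-p001 : ∀ {m} p s (w : Vec Bool m) →
  isLucasString (p ∷ false ∷ false ∷ true ∷ s ∷ w) ≡ not s ∧ lucasTail p (s ∷ w)
isLucasString-p001 true true w = refl
isLucasString-p001 true false w = refl
isLucasString-p001 false true w = refl
isLucasString-p001 false false w = refl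

isLucasString-p11 : ∀ {m} p (v : Vec Bool m) → isLucasString (p ∷ true ∷ true ∷ v) ≡ false
isLucasString-p11 true v = refl
isLucasString-p11 false v = refl

isLucasString-p011 : ∀ {m} p (v : Vec Bool m) → isLucasString (p ∷ false ∷ true ∷ true ∷ v) ≡ false
isLucasString-p011 true v = refl
isLucasString-p011 false v = refl

lucasDegree-p000 : ∀ {m} p s (w : Vec Bool m) →
  lucasDegree (p ∷ false ∷ false ∷ false ∷ s ∷ w)
    ≡ lucasDegree (p ∷ false ∷ true ∷ false ∷ s ∷ w)
      + (𝟙 (not p ∧ lucasTail p (s ∷ w)) + 𝟙 (not s ∧ lucasTail p (s ∷ w)))
lucasDegree-p000 {m} p s w =
  -- lucasDegree unfolds into the flips of the four leading bits followed by the flips inside z.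
  begin
    lucasDegree (p ∷ false ∷ false ∷ false ∷ z)
  ≡⟨ cong₂ _+_ (cong 𝟙 (isLucasString-p0x0 (not p) false z))
       (cong₂ _+_ (cong 𝟙 (isLucasString-p100 p z))
         (cong₂ _+_ (cong 𝟙 (isLucasString-p0x0 p true z))
           (cong₂ _+_ (cong 𝟙 (isLucasString-p001 p s w)) (tail≡ false)))) ⟩
    a + (b + (𝟙 t + (c + R)))
  ≡⟨ regroup a b (𝟙 t) c R ⟩
    a + (0 + (𝟙 t + (0 + R))) + (b + c)
  ≡⟨ cong (_+ (b + c)) (sym
       (cong₂ _+_ (cong 𝟙 (isLucasString-p0x0 (not p) true z))
         (cong₂ _+_ (cong 𝟙 (isLucasString-p11 p (false ∷ z)))
           (cong₂ _+_ (cong 𝟙 (isLucasString-p0x0 p false z))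
             (cong₂ _+_ (cong 𝟙 (isLucasString-p011 p z)) (tail≡ true)))))) ⟩
    lucasDegree (p ∷ false ∷ true ∷ false ∷ z) + (b + c)
  ∎
  where
  z : Vec Bool (suc m)
  z = s ∷ w
  t : Bool
  t = lucasTail p z
  a b c R : ℕ
  a = 𝟙 (lucasTail (not p) z)
  b = 𝟙 (not p ∧ t)
  c = 𝟙 (not s ∧ t)
  R = ∑Neighbours (λ z′ → 𝟙 (lucasTail p z′)) z
  tail≡ : ∀ x → ∑Neighbours (λ z′ → 𝟙 (isLucasString (p ∷ false ∷ x ∷ false ∷ z′))) z ≡ R
  tail≡ x = ∑Below-cong (suc m) (λ j → cong 𝟙 (isLucasString-p0x0 p x (flipAt j z)))
  regroup : ∀ a b t c R → a + (b + (t + (c + R))) ≡ a + (0 + (t + (0 + R))) + (b + c)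
  regroup = solve-∀

∧-imbalance-excess : ∀ (P : ℕ → Bool) t a b d →
  t ∧ (t ∧ P ∣ d + (𝟙 (a ∧ t) + 𝟙 (b ∧ t)) - d ∣) ≡ P (𝟙 a + 𝟙 b) ∧ t
∧-imbalance-excess P false a b d = sym (∧-zeroʳ _)
∧-imbalance-excess P true a b d =
  trans (cong P (trans (∣-∣-comm (d + _) d)
                       (trans (∣m-m+n∣≡n d _) (cong₂ (λ x y → 𝟙 x + 𝟙 y) (∧-identityʳ a) (∧-identityʳ b)))))
        (sym (∧-identityʳ _))

lucasPairWith-p0x0 : ∀ {m} P p s (w : Vec Bool m) →
  lucasPairWith P (p ∷ false ∷ false ∷ false ∷ s ∷ w) (p ∷ false ∷ true ∷ false ∷ s ∷ w)
    ≡ P (𝟙 (not p) + 𝟙 (not s)) ∧ lucasTail p (s ∷ w)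
lucasPairWith-p0x0 P p s w =
  begin
    lucasPairWith P (p ∷ false ∷ false ∷ false ∷ s ∷ w) u′
  ≡⟨ cong₂ _∧_ (isLucasString-p0x0 p false (s ∷ w))
       (cong₂ (λ b d → b ∧ P ∣ d - lucasDegree u′ ∣)
              (isLucasString-p0x0 p true (s ∷ w)) (lucasDegree-p000 p s w)) ⟩
    t ∧ (t ∧ P ∣ lucasDegree u′ + (𝟙 (not p ∧ t) + 𝟙 (not s ∧ t)) - lucasDegree u′ ∣)
  ≡⟨ ∧-imbalance-excess P t (not p) (not s) (lucasDegree u′) ⟩
    P (𝟙 (not p) + 𝟙 (not s)) ∧ t
  ∎
  where
  u′ : Vec Bool _
  u′ = p ∷ false ∷ true ∷ false ∷ s ∷ w
  t : Bool
  t = lucasTail p (s ∷ w)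

lucasPairWith-nonLucasˡ : ∀ {n} P (u v : Vec Bool n) → isLucasString u ≡ false → lucasPairWith P u v ≡ false
lucasPairWith-nonLucasˡ P u v u∉Λ = cong (_∧ (isLucasString v ∧ P ∣ lucasDegree u - lucasDegree v ∣)) u∉Λ

lucasPairWith-nonLucasʳ : ∀ {n} P (u v : Vec Bool n) → isLucasString v ≡ false → lucasPairWith P u v ≡ false
lucasPairWith-nonLucasʳ P u v v∉Λ = trans (lucasPairWith-sym P u v) (lucasPairWith-nonLucasˡ P v u v∉Λ)

lucasPairWith-p1x : ∀ {m} P p x (v : Vec Bool m) →
  lucasPairWith P (p ∷ true ∷ x ∷ v) (p ∷ true ∷ not x ∷ v) ≡ false
lucasPairWith-p1x P p true v =
  lucasPairWith-nonLucasˡ P (p ∷ true ∷ true ∷ v) (p ∷ true ∷ false ∷ v) (isLucasString-p11 p v)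
lucasPairWith-p1x P p false v =
  lucasPairWith-nonLucasʳ P (p ∷ true ∷ false ∷ v) (p ∷ true ∷ true ∷ v) (isLucasString-p11 p v)

lucasPairWith-p0x1 : ∀ {m} P p x (v : Vec Bool m) →
  lucasPairWith P (p ∷ false ∷ x ∷ true ∷ v) (p ∷ false ∷ not x ∷ true ∷ v) ≡ false
lucasPairWith-p0x1 P p true v =
  lucasPairWith-nonLucasˡ P (p ∷ false ∷ true ∷ true ∷ v) (p ∷ false ∷ false ∷ true ∷ v) (isLucasString-p011 p v)
lucasPairWith-p0x1 P p false v =
  lucasPairWith-nonLucasʳ P (p ∷ false ∷ false ∷ true ∷ v) (p ∷ false ∷ true ∷ true ∷ v) (isLucasString-p011 p v)

tailCount : Bool → Bool → ℕ → ℕ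
tailCount p s m = ∑Strings m (λ w → 𝟙 (lucasTail p (s ∷ w)))

tailCount-ff : ∀ m → tailCount false false m ≡ fib (2 + m)
tailCount-tf : ∀ m → tailCount true false m ≡ fib (1 + m)
tailCount-ft : ∀ m → tailCount false true m ≡ fib (1 + m)
tailCount-tt : ∀ m → tailCount true true m ≡ fib m
tailCount-ff zero = refl
tailCount-ff (suc m) = cong₂ _+_ (tailCount-ff m) (tailCount-ft m)
tailCount-tf zero = refl
tailCount-tf (suc m) = cong₂ _+_ (tailCount-tf m) (tailCount-tt m)
tailCount-ft zero = refl
tailCount-ft (suc m) = trans (cong₂ _+_ (tailCount-ff m) (∑Strings-zero m (λ _ → refl))) (+-identityʳ _)
tailCount-tt zero = refl
tailCount-tt (suc m) = trans (cong₂ _+_ (tailCount-tf m) (∑Strings-zero m (λ _ → refl))) (+-identityʳ _)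

∑Strings-p00 : ∀ m P p →
  ∑Strings (2 + m) (λ v → 𝟙 (lucasPairWith P (p ∷ false ∷ false ∷ v) (p ∷ false ∷ true ∷ v)))
    ≡ 𝟙 (P (𝟙 (not p) + 1)) * tailCount p false m + 𝟙 (P (𝟙 (not p) + 0)) * tailCount p true m
∑Strings-p00 m P p =
  trans (cong₂ _+_ (cong₂ _+_ (gap false) (gap true))
                   (∑Strings-zero (suc m) (λ z → cong 𝟙 (lucasPairWith-p0x1 P p false z))))
        (+-identityʳ _)
  where
  gap : ∀ s →
    ∑Strings m (λ w → 𝟙 (lucasPairWith P (p ∷ false ∷ false ∷ false ∷ s ∷ w) (p ∷ false ∷ true ∷ false ∷ s ∷ w)))
      ≡ 𝟙 (P (𝟙 (not p) + 𝟙 (not s))) * tailCount p s m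
  gap s = trans (∑Strings-cong m (λ w → trans (cong 𝟙 (lucasPairWith-p0x0 P p s w)) (𝟙-∧ (P c) _)))
                (∑Strings-*ˡ m (𝟙 (P c)) (λ w → 𝟙 (lucasTail p (s ∷ w))))
    where
    c : ℕ
    c = 𝟙 (not p) + 𝟙 (not s)

∑Strings-flip₂ : ∀ m P p →
  ∑Strings (4 + m) (λ v → 𝟙 (lucasPairWith P (p ∷ v) (flipAt 2 (p ∷ v))))
    ≡ 2 * (𝟙 (P (𝟙 (not p) + 1)) * tailCount p false m + 𝟙 (P (𝟙 (not p) + 0)) * tailCount p true m)
∑Strings-flip₂ m P p =
  -- Split by the second bit q and, for q = 0, by the flipped bit x: the half x = 1 is the half x = 0
  -- with the two ends of each edge swapped, and every edge with q = 1 has an end outside Λ_n.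
  begin
    (x₀ + x₁) + q₁
  ≡⟨ cong₂ _+_ (cong₂ _+_ (∑Strings-p00 m P p) x₁≡c) q₁≡0 ⟩
    (c + c) + 0
  ≡⟨ c+c+0≡2*c c ⟩
    2 * c
  ∎
  where
  x₀ x₁ q₁ c : ℕ
  x₀ = ∑Strings (2 + m) (λ v → 𝟙 (lucasPairWith P (p ∷ false ∷ false ∷ v) (p ∷ false ∷ true ∷ v)))
  x₁ = ∑Strings (2 + m) (λ v → 𝟙 (lucasPairWith P (p ∷ false ∷ true ∷ v) (p ∷ false ∷ false ∷ v)))
  q₁ = ∑Strings (3 + m) (λ v → 𝟙 (lucasPairWith P (p ∷ true ∷ v) (flipAt 2 (p ∷ true ∷ v))))
  c = 𝟙 (P (𝟙 (not p) + 1)) * tailCount p false m + 𝟙 (P (𝟙 (not p) + 0)) * tailCount p true m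
  x₁≡c : x₁ ≡ c
  x₁≡c =
    trans (∑Strings-cong (2 + m) (λ v → cong 𝟙 (lucasPairWith-sym P (p ∷ false ∷ true ∷ v) (p ∷ false ∷ false ∷ v))))
          (∑Strings-p00 m P p)
  q₁≡0 : q₁ ≡ 0
  q₁≡0 = ∑Strings-zero (3 + m) {λ v → 𝟙 (lucasPairWith P (p ∷ true ∷ v) (flipAt 2 (p ∷ true ∷ v)))}
                       (λ { (x ∷ v) → cong 𝟙 (lucasPairWith-p1x P p x v) })
  c+c+0≡2*c : ∀ c → c + c + 0 ≡ 2 * c
  c+c+0≡2*c = solve-∀

flipCount-2 : ∀ m P →
  flipCount (5 + m) P 2 ≡ 2 * (𝟙 (P 0) * fib m + 𝟙 (P 1) * (2 * fib (1 + m)) + 𝟙 (P 2) * fib (2 + m))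
flipCount-2 m P =
  begin
    flipCount (5 + m) P 2
  ≡⟨ cong₂ _+_ (∑Strings-flip₂ m P false) (∑Strings-flip₂ m P true) ⟩
    2 * (𝟙 (P 2) * tailCount false false m + 𝟙 (P 1) * tailCount false true m)
      + 2 * (𝟙 (P 1) * tailCount true false m + 𝟙 (P 0) * tailCount true true m)
  ≡⟨ cong₂ _+_ (cong₂ (λ a b → 2 * (𝟙 (P 2) * a + 𝟙 (P 1) * b)) (tailCount-ff m) (tailCount-ft m))
               (cong₂ (λ a b → 2 * (𝟙 (P 1) * a + 𝟙 (P 0) * b)) (tailCount-tf m) (tailCount-tt m)) ⟩
    2 * (𝟙 (P 2) * fib (2 + m) + 𝟙 (P 1) * fib (1 + m)) + 2 * (𝟙 (P 1) * fib (1 + m) + 𝟙 (P 0) * fib m)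
  ≡⟨ collect (𝟙 (P 0)) (𝟙 (P 1)) (𝟙 (P 2)) (fib m) (fib (1 + m)) (fib (2 + m)) ⟩
    2 * (𝟙 (P 0) * fib m + 𝟙 (P 1) * (2 * fib (1 + m)) + 𝟙 (P 2) * fib (2 + m))
  ∎
  where
  collect : ∀ a b c x y z → 2 * (c * z + b * y) + 2 * (b * y + a * x) ≡ 2 * (a * x + b * (2 * y) + c * z)
  collect = solve-∀

edgeCount : ∀ m {ℓ} {Q : Pred ℕ ℓ} (Q? : Decidable Q) →
  length (filter (λ e → Q? (imbalance (5 + m) e)) (edges (5 + m)))
    ≡ (5 + m) * (𝟙 (does (Q? 0)) * fib m + 𝟙 (does (Q? 1)) * (2 * fib (1 + m)) + 𝟙 (does (Q? 2)) * fib (2 + m))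
edgeCount m Q? = *-cancelˡ-≡ _ _ 2
  (begin
    2 * length (filter (λ e → Q? (imbalance n e)) (edges n))
  ≡⟨ 2*edges≡∑flipCount n Q? ⟩
    ∑Below n (flipCount n P)
  ≡⟨ ∑Below-const n (flipCount n P) (flipCount n P 2)
       (λ j j<n → trans (flipCount-const n P j j<n) (sym (flipCount-const n P 2 (s≤s (s≤s (s≤s z≤n)))))) ⟩
    n * flipCount n P 2
  ≡⟨ cong (n *_) (flipCount-2 m P) ⟩
    n * (2 * X)
  ≡⟨ x*yz≡y*xz n 2 X ⟩
    2 * (n * X)
  ∎)
  where
  n X : ℕ
  n = 5 + m
  X = 𝟙 (does (Q? 0)) * fib m + 𝟙 (does (Q? 1)) * (2 * fib (1 + m)) + 𝟙 (does (Q? 2)) * fib (2 + m)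
  P : ℕ → Bool
  P d = does (Q? d)

mainTheorem12 : (n : ℕ) → 5 ≤ n →
    All (λ e → imbalance n e ≤ 2) (edges n)
    × length (edgesWithImbalance n 0) ≡ n * fib (n ∸ 5)
    × length (edgesWithImbalance n 1) ≡ 2 * n * fib (n ∸ 4)
    × length (edgesWithImbalance n 2) ≡ n * fib (n ∸ 3)
mainTheorem12 n (s≤s (s≤s (s≤s (s≤s (s≤s (z≤n {n = m})))))) =
    All.map ≮⇒≥ (length-filter≡0⇒All∁ (λ e → 2 <? imbalance n e) (edges n)
                                      (trans (edgeCount m (2 <?_)) (*-zeroʳ n)))
  , trans (edgeCount m (_≟ 0)) (only₀ n (fib m) (2 * fib (1 + m)) (fib (2 + m)))
  , trans (edgeCount m (_≟ 1)) (only₁ n (fib m) (fib (1 + m)) (fib (2 + m)))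
  , trans (edgeCount m (_≟ 2)) (only₂ n (fib m) (2 * fib (1 + m)) (fib (2 + m)))
  where
  only₀ : ∀ n x y z → n * (1 * x + 0 * y + 0 * z) ≡ n * x
  only₀ = solve-∀
  only₁ : ∀ n x y z → n * (0 * x + 1 * (2 * y) + 0 * z) ≡ 2 * n * y
  only₁ = solve-∀
  only₂ : ∀ n x y z → n * (0 * x + 0 * y + 1 * z) ≡ n * z
  only₂ = solve-∀
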